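{- Let $n,a\in\mathbb{N}$. The sequence $({}^k a \bmod n)_{k\in\mathbb{N}_0}$ is eventually periodic with period length $1$ (i.e. eventually constant), and its preperiod has length at most $H(n)+1$; that is, ${}^ka\equiv{}^{H(n)+1}a\pmod n$ for all $k\ge H(n)+1$.
   Context: Tetration: ${}^0a=1$, ${}^ka=a^{({}^{k-1}a)}$ for $k\in\mathbb{N}$. $\lambda$ is Carmichael's function ($\lambda(n)$ is the exponent of $(\mathbb{Z}/n\mathbb{Z})^*$), $\lambda^{(0)}(n)=n$, $\lambda^{(k)}=\lambda\circ\lambda^{(k-1)}$, and $H(n)=\min\{\alpha\ge0:\lambda^{(\alpha)}(n)=1\}$. -}

module Defs where

open import Data.Nat using (ℕ; zero; suc; _^_; _≤_; ∣_-_∣)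
open import Data.Nat.Divisibility using (_∣_)
open import Data.Nat.Coprimality using (Coprime)
open import Data.Product using (_×_)
open import Relation.Binary.PropositionalEquality using (_≡_)

infix 4 _≋_[mod_]
_≋_[mod_] : ℕ → ℕ → ℕ → Set
a ≋ b [mod n ] = n ∣ ∣ a - b ∣

tet : ℕ → ℕ → ℕ
tet a zero    = 1
tet a (suc k) = a ^ tet a k

IsExponentMod : ℕ → ℕ → Set
IsExponentMod n m = ∀ x → Coprime x n → x ^ m ≋ 1 [mod n ]

IsCarmichael : ℕ → ℕ → Set
IsCarmichael n m = 1 ≤ m × IsExponentMod n m × (∀ m' → 1 ≤ m' → IsExponentMod n m' → m ≤ m')

iter : (ℕ → ℕ) → ℕ → ℕ → ℕ
iter f zero    x = x
iter f (suc k) x = f (iter f k x)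

IsH : (ℕ → ℕ) → ℕ → ℕ → Set
IsH lam n h = iter lam h n ≡ 1 × (∀ α → iter lam α n ≡ 1 → h ≤ α)

{-# OPTIONS --safe #-}
module Submission where

-- Induction on h: for k > h + 1, ᵏa = a^(ᵏ⁻¹a) and ᵏ⁻¹a ≡ ʰ⁺¹a (mod λ(n)) by the induction
-- hypothesis for λ(n). Powers a^x, a^y with x ≡ y (mod λ(n)) agree modulo n once x and y are at
-- least y₀, where d^(1+y₀) ∤ n for every divisor d ≥ 2 of a: split n = v u with u ∣ a^y₀ and
-- v coprime to a; u divides both powers, and v divides a^x − a^y because a ≡ v + a (mod v)
-- with v + a a unit modulo n. Such a y₀ is ʰ⁺¹a ≥ 2^(h+1): if m² ∣ n then m ∣ λ(n), since
-- (1 + n/m)^λ(n) ≡ 1 + λ(n) n/m (mod n); iterating, λ^(j)(n) = 1 forbids m^(2^j) ∣ n for m ≥ 2.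

open import Data.Nat
open import Data.Nat.Coprimality as Coprimality using (Coprime; coprime-+; coprime-divisor; coprime-/gcd)
open import Data.Nat.Divisibility
open import Data.Nat.DivMod using (m/n*n≡m)
open import Data.Nat.GCD using (gcd; gcd[m,n]∣m; gcd[m,n]∣n; gcd[m,n]≡0⇒m≡0)
open import Data.Nat.Properties
open import Data.Nat.Tactic.RingSolver using (solve-∀)
open import Data.Empty using (⊥-elim)
open import Data.Product using (∃₂; _×_; _,_)
open import Function.Base using (_∘_)
open import Data.Sum using (inj₁; inj₂)
open import Relation.Binary.Bundles using (Setoid)
import Relation.Binary.Reasoning.Setoid
open import Relation.Binary.Structures using (IsEquivalence)
open import Relation.Binary.PropositionalEquality
open import Defs

module _ {n : ℕ} where

  ≋-refl : ∀ {a} → a ≋ a [mod n ]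
  ≋-refl {a} = subst (n ∣_) (sym (∣n-n∣≡0 a)) (n ∣0)

  ≋-sym : ∀ {a b} → a ≋ b [mod n ] → b ≋ a [mod n ]
  ≋-sym {a} {b} = subst (n ∣_) (∣-∣-comm a b)

  private
    ≤∧≋⇒∃ : ∀ {a b} → a ≤ b → a ≋ b [mod n ] → ∃₂ λ i j → a + i * n ≡ b + j * n
    ≤∧≋⇒∃ {a} {b} a≤b (divides q ∣a-b∣≡q*n) = q , 0 , (begin
      a + q * n    ≡⟨ cong (a +_) (trans (sym ∣a-b∣≡q*n) (m≤n⇒∣m-n∣≡n∸m a≤b)) ⟩
      a + (b ∸ a)  ≡⟨ m+[n∸m]≡n a≤b ⟩
      b            ≡⟨ sym (+-identityʳ b) ⟩
      b + 0 * n    ∎)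
      where open ≡-Reasoning

  ≋⇒∃ : ∀ {a b} → a ≋ b [mod n ] → ∃₂ λ i j → a + i * n ≡ b + j * n
  ≋⇒∃ {a} {b} a≋b with ≤-total a b
  ... | inj₁ a≤b = ≤∧≋⇒∃ a≤b a≋b
  ... | inj₂ b≤a with ≤∧≋⇒∃ b≤a (≋-sym {a} {b} a≋b)
  ...   | i , j , b+i*n≡a+j*n = j , i , sym b+i*n≡a+j*n

  ∃⇒≋ : ∀ {a b} i j → a + i * n ≡ b + j * n → a ≋ b [mod n ]
  ∃⇒≋ {a} {b} i j eq = subst (n ∣_) ∣j-i∣*n≡∣a-b∣ (n∣m*n ∣ j - i ∣)
    where
    open ≡-Reasoning
    ∣j-i∣*n≡∣a-b∣ : ∣ j - i ∣ * n ≡ ∣ a - b ∣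
    ∣j-i∣*n≡∣a-b∣ = begin
      ∣ j - i ∣ * n                    ≡⟨ *-distribʳ-∣-∣ n j i ⟩
      ∣ j * n - i * n ∣                ≡⟨ sym (∣m+n-m+o∣≡∣n-o∣ b (j * n) (i * n)) ⟩
      ∣ b + j * n - b + i * n ∣        ≡⟨ cong ∣_- b + i * n ∣ (sym eq) ⟩
      ∣ a + i * n - b + i * n ∣        ≡⟨ cong₂ ∣_-_∣ (+-comm a (i * n)) (+-comm b (i * n)) ⟩
      ∣ i * n + a - i * n + b ∣        ≡⟨ ∣m+n-m+o∣≡∣n-o∣ (i * n) a b ⟩
      ∣ a - b ∣                        ∎

  ≋-trans : ∀ {a b c} → a ≋ b [mod n ] → b ≋ c [mod n ] → a ≋ c [mod n ]
  ≋-trans {a} {b} {c} a≋b b≋c with ≋⇒∃ a≋b | ≋⇒∃ b≋c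
  ... | i , j , a+i*n≡b+j*n | k , l , b+k*n≡c+l*n = ∃⇒≋ (i + k) (l + j) (begin
    a + (i + k) * n      ≡⟨ regroup a i k ⟩
    a + i * n + k * n    ≡⟨ cong (_+ k * n) a+i*n≡b+j*n ⟩
    b + j * n + k * n    ≡⟨ swap b (j * n) (k * n) ⟩
    b + k * n + j * n    ≡⟨ cong (_+ j * n) b+k*n≡c+l*n ⟩
    c + l * n + j * n    ≡⟨ sym (regroup c l j) ⟩
    c + (l + j) * n      ∎)
    where
    open ≡-Reasoning
    regroup : ∀ x p q → x + (p + q) * n ≡ x + p * n + q * n
    regroup x p q = trans (cong (x +_) (*-distribʳ-+ n p q)) (sym (+-assoc x (p * n) (q * n)))
    swap : ∀ x p q → x + p + q ≡ x + q + p
    swap = solve-∀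

  ≋-isEquivalence : IsEquivalence (_≋_[mod n ])
  ≋-isEquivalence = record
    { refl  = λ {a} → ≋-refl {a}
    ; sym   = λ {a} {b} → ≋-sym {a} {b}
    ; trans = λ {a} {b} {c} → ≋-trans {a} {b} {c}
    }

  ≋-+-multiple : ∀ {a m} → n ∣ m → a ≋ a + m [mod n ]
  ≋-+-multiple {a} {m} = subst (n ∣_) (sym (∣m-m+n∣≡n a m))

  ≋-*-congʳ : ∀ c {a b} → a ≋ b [mod n ] → a * c ≋ b * c [mod n ]
  ≋-*-congʳ c {a} {b} a≋b = subst (n ∣_) (*-distribʳ-∣-∣ c a b) (∣m⇒∣m*n c a≋b)

  ≋-*-congˡ : ∀ c {a b} → a ≋ b [mod n ] → c * a ≋ c * b [mod n ]
  ≋-*-congˡ c {a} {b} a≋b = subst (n ∣_) (*-distribˡ-∣-∣ c a b) (∣n⇒∣m*n c a≋b)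

  ≋-*-cong : ∀ {a b c d} → a ≋ b [mod n ] → c ≋ d [mod n ] → a * c ≋ b * d [mod n ]
  ≋-*-cong {a} {b} {c} {d} a≋b c≋d =
    ≋-trans {a * c} {b * c} {b * d} (≋-*-congʳ c {a} {b} a≋b) (≋-*-congˡ b {c} {d} c≋d)

  ≋-^-cong : ∀ k {a b} → a ≋ b [mod n ] → a ^ k ≋ b ^ k [mod n ]
  ≋-^-cong zero            a≋b = ≋-refl {1}
  ≋-^-cong (suc k) {a} {b} a≋b = ≋-*-cong {a} {b} {a ^ k} {b ^ k} a≋b (≋-^-cong k a≋b)

≋-setoid : ℕ → Setoid _ _
≋-setoid n = record { Carrier = ℕ ; _≈_ = _≋_[mod n ] ; isEquivalence = ≋-isEquivalence }

module ≋-Reasoning (n : ℕ) = Relation.Binary.Reasoning.Setoid (≋-setoid n)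

coprime-∣ˡ : ∀ {d m n} → d ∣ m → Coprime m n → Coprime d n
coprime-∣ˡ d∣m coprime (i∣d , i∣n) = coprime (∣-trans i∣d d∣m , i∣n)

coprime-∣ʳ : ∀ {d m n} → d ∣ n → Coprime m n → Coprime m d
coprime-∣ʳ d∣n coprime (i∣m , i∣d) = coprime (i∣m , ∣-trans i∣d d∣n)

coprime-*ʳ : ∀ {m n o} → Coprime m n → Coprime m o → Coprime m (n * o)
coprime-*ʳ m⊥n m⊥o (i∣m , i∣n*o) = m⊥o (i∣m , coprime-divisor (coprime-∣ˡ i∣m m⊥n) i∣n*o)

coprime-^ʳ : ∀ {m n} → Coprime m n → ∀ k → Coprime m (n ^ k)
coprime-^ʳ m⊥n zero    (_ , i∣1) = ∣1⇒≡1 i∣1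
coprime-^ʳ m⊥n (suc k) = coprime-*ʳ m⊥n (coprime-^ʳ m⊥n k)

^-monoˡ-∣ : ∀ {m n} k → m ∣ n → m ^ k ∣ n ^ k
^-monoˡ-∣ zero    m∣n = ∣-refl
^-monoˡ-∣ (suc k) m∣n = *-pres-∣ m∣n (^-monoˡ-∣ k m∣n)

^-monoʳ-∣ : ∀ m {j k} → j ≤ k → m ^ j ∣ m ^ k
^-monoʳ-∣ m {j} j≤k with m≤n⇒∃[o]m+o≡n j≤k
... | o , refl = subst (m ^ j ∣_) (sym (^-distribˡ-+-* m j o)) (m∣m*n (m ^ o))

[1+m]^k≋1+k*m : ∀ {n m} → n ∣ m * m → ∀ k → (1 + m) ^ k ≋ 1 + k * m [mod n ]
[1+m]^k≋1+k*m {n} {m} n∣m*m zero    = ≋-refl {n} {1}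
[1+m]^k≋1+k*m {n} {m} n∣m*m (suc k) = begin
  (1 + m) * (1 + m) ^ k              ≈⟨ ≋-*-congˡ (1 + m) {(1 + m) ^ k} ([1+m]^k≋1+k*m n∣m*m k) ⟩
  (1 + m) * (1 + k * m)              ≡⟨ expand k m ⟩
  1 + suc k * m + k * (m * m)        ≈⟨ ≋-+-multiple {a = 1 + suc k * m} (∣n⇒∣m*n k n∣m*m) ⟨
  1 + suc k * m                      ∎
  where
  open ≋-Reasoning n
  expand : ∀ k m → (1 + m) * (1 + k * m) ≡ 1 + (1 + k) * m + k * (m * m)
  expand = solve-∀

n∣m*m⇒n∣exponent*m : ∀ {n L m} → IsExponentMod n L → n ∣ m * m → n ∣ L * m
n∣m*m⇒n∣exponent*m {n} {L} {m} exponent n∣m*m =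
  subst (n ∣_) (∣-∣-identityʳ (L * m)) 1+L*m≋1
  where
  1+m⊥m : Coprime (1 + m) m
  1+m⊥m = subst (λ x → Coprime x m) (+-comm m 1) (coprime-+ (λ (i∣1 , _) → ∣1⇒≡1 i∣1))
  1+m⊥n : Coprime (1 + m) n
  1+m⊥n = coprime-∣ʳ n∣m*m (coprime-*ʳ 1+m⊥m 1+m⊥m)
  1+L*m≋1 : 1 + L * m ≋ 1 [mod n ]
  1+L*m≋1 = ≋-trans {n} {1 + L * m} {(1 + m) ^ L}
    (≋-sym {n} {(1 + m) ^ L} ([1+m]^k≋1+k*m n∣m*m L)) (exponent (1 + m) 1+m⊥n)

m*m∣n⇒m∣exponent : ∀ {n L m} → 1 ≤ n → IsExponentMod n L → m * m ∣ n → m ∣ L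
m*m∣n⇒m∣exponent {n} {L} {m} n≥1 exponent (divides k n≡k*[m*m]) =
  *-cancelˡ-∣ N {{N≢0}} (subst₂ _∣_ n≡N*m (*-comm L N) (n∣m*m⇒n∣exponent*m {n} {L} {N} exponent n∣N*N))
  where
  open ≡-Reasoning
  N : ℕ
  N = k * m
  n≡N*m : n ≡ N * m
  n≡N*m = trans n≡k*[m*m] (sym (*-assoc k m m))
  N≢0 : NonZero N
  N≢0 = m*n≢0⇒m≢0 N {{subst NonZero n≡N*m (>-nonZero n≥1)}}
  n∣N*N : n ∣ N * N
  n∣N*N = divides k (begin
    k * m * (k * m)      ≡⟨ regroup k m ⟩
    k * (k * (m * m))    ≡⟨ cong (k *_) n≡k*[m*m] ⟨
    k * n                ∎)
    where
    regroup : ∀ k m → k * m * (k * m) ≡ k * (k * (m * m))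
    regroup = solve-∀

DivisorPowerBound : ℕ → ℕ → ℕ → Set
DivisorPowerBound n a y₀ = ∀ d → 2 ≤ d → d ∣ a → d ^ suc y₀ ∤ n

gcd-split : ∀ {n a y₀} → 1 ≤ n → DivisorPowerBound n a y₀ →
            ∃₂ λ v u → n ≡ v * u × u ∣ a ^ y₀ × Coprime v a
gcd-split {n} {a} {y₀} n≥1 bound = v , g , n≡v*g , gcd[m,n]∣n n (a ^ y₀) , v⊥a
  where
  n≢0 : n ≢ 0
  n≢0 = ≢-nonZero⁻¹ n {{>-nonZero n≥1}}
  g : ℕ
  g = gcd n (a ^ y₀)
  instance
    g≢0 : NonZero g
    g≢0 = ≢-nonZero (n≢0 ∘ gcd[m,n]≡0⇒m≡0)
  v w : ℕ
  v = n / g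
  w = a ^ y₀ / g
  n≡v*g : n ≡ v * g
  n≡v*g = sym (m/n*n≡m (gcd[m,n]∣m n (a ^ y₀)))
  a^y₀≡w*g : a ^ y₀ ≡ w * g
  a^y₀≡w*g = sym (m/n*n≡m (gcd[m,n]∣n n (a ^ y₀)))
  v⊥w : Coprime v w
  v⊥w = coprime-/gcd n (a ^ y₀)
  v⊥a : Coprime v a
  v⊥a {zero}        (0∣v , _)   = ⊥-elim (n≢0 (trans n≡v*g (cong (_* g) (0∣⇒≡0 0∣v))))
  v⊥a {suc zero}    _           = refl
  v⊥a {d@(2+ _)}    (d∣v , d∣a) = ⊥-elim (bound d (s≤s (s≤s z≤n)) d∣a d^[1+y₀]∣n)
    where
    d^y₀⊥w : Coprime (d ^ y₀) w
    d^y₀⊥w = coprime-∣ˡ (^-monoˡ-∣ y₀ d∣v) (Coprimality.sym (coprime-^ʳ (Coprimality.sym v⊥w) y₀))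
    d^y₀∣g : d ^ y₀ ∣ g
    d^y₀∣g = coprime-divisor d^y₀⊥w (subst (d ^ y₀ ∣_) a^y₀≡w*g (^-monoˡ-∣ y₀ d∣a))
    d^[1+y₀]∣n : d ^ suc y₀ ∣ n
    d^[1+y₀]∣n = subst (d ^ suc y₀ ∣_) (sym n≡v*g) (*-pres-∣ d∣v d^y₀∣g)

^-periodic : ∀ {n L a y₀ v u} → IsExponentMod n L → n ≡ v * u → u ∣ a ^ y₀ → Coprime v a →
             ∀ y d → y₀ ≤ y → L ∣ d → a ^ (y + d) ≋ a ^ y [mod n ]
^-periodic {L = L} {a} {y₀} {v} {u} exponent refl u∣a^y₀ v⊥a y d y₀≤y (divides q d≡q*L) =
  subst (v * u ∣_) ∣a^d-1∣*a^y≡∣a^[y+d]-a^y∣ (*-pres-∣ a^d≋1 (∣-trans u∣a^y₀ (^-monoʳ-∣ a y₀≤y)))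
  where
  -- z ≡ a (mod v), but unlike a it is a unit modulo n = v u.
  z : ℕ
  z = v + a
  z⊥n : Coprime z (v * u)
  z⊥n = coprime-*ʳ (coprime-+ (Coprimality.sym v⊥a)) (coprime-∣ʳ u∣a^y₀ (coprime-^ʳ z⊥a y₀))
    where
    z⊥a : Coprime z a
    z⊥a = subst (λ x → Coprime x a) (+-comm a v) (coprime-+ v⊥a)
  a^d≋1 : a ^ d ≋ 1 [mod v ]
  a^d≋1 = begin
    a ^ d              ≈⟨ ≋-^-cong d {a} (≋-+-multiple {a = a} ∣-refl) ⟩
    (a + v) ^ d        ≡⟨ cong₂ _^_ (+-comm a v) (trans d≡q*L (*-comm q L)) ⟩
    z ^ (L * q)        ≡⟨ ^-*-assoc z L q ⟨
    (z ^ L) ^ q        ≈⟨ ≋-^-cong q {z ^ L} (∣-trans (m∣m*n u) (exponent z z⊥n)) ⟩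
    1 ^ q              ≡⟨ ^-zeroˡ q ⟩
    1                  ∎
    where open ≋-Reasoning v
  ∣a^d-1∣*a^y≡∣a^[y+d]-a^y∣ : ∣ a ^ d - 1 ∣ * a ^ y ≡ ∣ a ^ (y + d) - a ^ y ∣
  ∣a^d-1∣*a^y≡∣a^[y+d]-a^y∣ = begin
    ∣ a ^ d - 1 ∣ * a ^ y              ≡⟨ *-distribʳ-∣-∣ (a ^ y) (a ^ d) 1 ⟩
    ∣ a ^ d * a ^ y - 1 * a ^ y ∣      ≡⟨ cong₂ ∣_-_∣ a^d*a^y≡a^[y+d] (*-identityˡ (a ^ y)) ⟩
    ∣ a ^ (y + d) - a ^ y ∣            ∎
    where
    open ≡-Reasoning
    a^d*a^y≡a^[y+d] : a ^ d * a ^ y ≡ a ^ (y + d)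
    a^d*a^y≡a^[y+d] = trans (sym (^-distribˡ-+-* a d y)) (cong (a ^_) (+-comm d y))

^-congʳ-≋ : ∀ {n L a y₀} → 1 ≤ n → IsExponentMod n L → DivisorPowerBound n a y₀ →
            ∀ {x y} → y₀ ≤ y → y ≤ x → x ≋ y [mod L ] → a ^ x ≋ a ^ y [mod n ]
^-congʳ-≋ {n} {L} {a} {y₀} n≥1 exponent bound {x} {y} y₀≤y y≤x x≋y
  with gcd-split {y₀ = y₀} n≥1 bound
... | v , u , n≡v*u , u∣a^y₀ , v⊥a =
  subst (λ e → a ^ e ≋ a ^ y [mod n ]) (m+[n∸m]≡n y≤x)
    (^-periodic exponent n≡v*u u∣a^y₀ v⊥a y (x ∸ y) y₀≤y (subst (L ∣_) (m≤n⇒∣n-m∣≡n∸m y≤x) x≋y))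

n<2^n : ∀ n → n < 2 ^ n
n<2^n zero    = s≤s z≤n
n<2^n (suc n) = begin-strict
  suc n          <⟨ s≤s (n<2^n n) ⟩
  suc (2 ^ n)    ≤⟨ +-monoˡ-≤ (2 ^ n) (m^n>0 2 n) ⟩
  2 ^ n + 2 ^ n  ≡⟨ cong (2 ^ n +_) (+-identityʳ (2 ^ n)) ⟨
  2 ^ suc n      ∎
  where open ≤-Reasoning

tet-step : ∀ {a} → 1 ≤ a → ∀ k → tet a k ≤ tet a (suc k)
tet-step {suc _}     _   zero    = s≤s z≤n
tet-step {a@(suc _)} a≥1 (suc k) = ^-monoʳ-≤ a (tet-step a≥1 k)

tet-mono : ∀ {a} → 1 ≤ a → ∀ {j k} → j ≤ k → tet a j ≤ tet a k
tet-mono {a} a≥1 j≤k = go (≤⇒≤′ j≤k)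
  where
  go : ∀ {j k} → j ≤′ k → tet a j ≤ tet a k
  go ≤′-refl                    = ≤-refl
  go {k = suc k} (≤′-step j≤′k) = ≤-trans (go j≤′k) (tet-step a≥1 k)

2^k≤tet : ∀ {a} → 2 ≤ a → ∀ k → 2 ^ k ≤ tet a k
2^k≤tet a≥2 zero = ≤-refl
2^k≤tet {a} a≥2 (suc k) = begin
  2 ^ suc k          ≤⟨ ^-monoʳ-≤ 2 (n<2^n k) ⟩
  2 ^ 2 ^ k          ≤⟨ ^-monoʳ-≤ 2 (2^k≤tet a≥2 k) ⟩
  2 ^ tet a k        ≤⟨ ^-monoˡ-≤ (tet a k) a≥2 ⟩
  a ^ tet a k        ∎
  where open ≤-Reasoning

iter-suc : ∀ f j x → iter f (suc j) x ≡ iter f j (f x)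
iter-suc f zero    x = refl
iter-suc f (suc j) x = cong f (iter-suc f j x)

module _ (lam : ℕ → ℕ) (carmichael : ∀ m → 1 ≤ m → IsCarmichael m (lam m)) where

  iter≡1⇒m^[2^j]∤n : ∀ j {n m} → 1 ≤ n → iter lam j n ≡ 1 → 2 ≤ m → m ^ (2 ^ j) ∤ n
  iter≡1⇒m^[2^j]∤n zero    {m = m} _ refl m≥2 = >⇒∤ (subst (1 <_) (sym (*-identityʳ m)) m≥2)
  iter≡1⇒m^[2^j]∤n (suc j) {n} {m} n≥1 λʲ⁺¹n≡1 m≥2 m^[2^[1+j]]∣n with carmichael n n≥1
  ... | λn≥1 , exponent , _ =
    iter≡1⇒m^[2^j]∤n j λn≥1 (trans (sym (iter-suc lam j n)) λʲ⁺¹n≡1) m≥2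
      (m*m∣n⇒m∣exponent n≥1 exponent (subst (_∣ n) m^[2^[1+j]]≡m^[2^j]² m^[2^[1+j]]∣n))
    where
    m^[2^[1+j]]≡m^[2^j]² : m ^ (2 ^ suc j) ≡ m ^ (2 ^ j) * m ^ (2 ^ j)
    m^[2^[1+j]]≡m^[2^j]² = trans (cong (λ e → m ^ (2 ^ j + e)) (+-identityʳ (2 ^ j)))
                            (^-distribˡ-+-* m (2 ^ j) (2 ^ j))

  tet-stable : ∀ h {n a} → 1 ≤ n → 1 ≤ a → iter lam h n ≡ 1 →
               ∀ k → suc h ≤ k → tet a k ≋ tet a (suc h) [mod n ]
  tet-stable zero    _ _ refl _ _ = 1∣ _
  tet-stable (suc h) {n} {a} n≥1 a≥1 λʰ⁺¹n≡1 (suc k) (s≤s h<k) with carmichael n n≥1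
  ... | λn≥1 , exponent , _ =
    ^-congʳ-≋ n≥1 exponent bound ≤-refl (tet-mono a≥1 h<k)
      (tet-stable h λn≥1 a≥1 (trans (sym (iter-suc lam h n)) λʰ⁺¹n≡1) k h<k)
    where
    bound : DivisorPowerBound n a (tet a (suc h))
    bound d d≥2 d∣a = iter≡1⇒m^[2^j]∤n (suc h) n≥1 λʰ⁺¹n≡1 d≥2 ∘ ∣-trans (^-monoʳ-∣ d 2^[1+h]≤1+tet)
      where
      a≥2 : 2 ≤ a
      a≥2 = ≤-trans d≥2 (∣⇒≤ {{>-nonZero a≥1}} d∣a)
      2^[1+h]≤1+tet : 2 ^ suc h ≤ suc (tet a (suc h))
      2^[1+h]≤1+tet = ≤-trans (2^k≤tet a≥2 (suc h)) (n≤1+n _)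

lemma4p1 : (lam : ℕ → ℕ) → (∀ m → 1 ≤ m → IsCarmichael m (lam m)) →
           ∀ n a → 1 ≤ n → 1 ≤ a → ∀ h → IsH lam n h →
           ∀ k → suc h ≤ k → tet a k ≋ tet a (suc h) [mod n ]
lemma4p1 lam carmichael n a n≥1 a≥1 h (λʰn≡1 , _) = tet-stable lam carmichael h n≥1 a≥1 λʰn≡1
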